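{- For any digraph $G$, we have $\gamma(G)\le \alpha(G)\cdot\vec{\chi}(G)$.
   Context: All digraphs are finite, loopless and simple (for any two vertices $u,v$ there is at most one arc with endpoints $\{u,v\}$). A vertex dominates itself and its out-neighbors; a dominating set is a set $S$ of vertices such that every vertex is in $S$ or is an out-neighbor of a vertex of $S$, and $\gamma(G)$ is the minimum size of a dominating set. $\alpha(G)$ is the independence number of the underlying undirected graph of $G$. The dichromatic number $\vec{\chi}(G)$ is the minimum number of classes in a partition of $V(G)$ such that each class induces an acyclic subdigraph. -}

module Defs where

open import Data.Nat using (ℕ; _≤_)
open import Data.Fin using (Fin)
open import Data.Bool using (Bool; true; false)
open import Data.Fin.Subset using (Subset; _∈_; ∣_∣)
open import Data.Product using (Σ; _×_; ∃)
open import Data.Sum using (_⊎_)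
open import Relation.Binary.PropositionalEquality using (_≡_)
open import Relation.Nullary using (¬_)
open import Relation.Nullary.Decidable using (isYes)
open import Data.Vec using (tabulate)
open import Data.Fin using (_≟_)

-- A finite, loopless, simple digraph on vertex set Fin n.
-- arc u v ≡ true means there is an arc u → v.
-- Simple: at most one arc between any two vertices (no 2-cycles).
record Digraph (n : ℕ) : Set where
  field
    arc      : Fin n → Fin n → Bool
    loopless : ∀ v → arc v v ≡ false
    simple   : ∀ u v → arc u v ≡ true → arc v u ≡ false
open Digraph public

module _ {n : ℕ} (G : Digraph n) where

  Dominating : Subset n → Set
  Dominating S = ∀ v → (v ∈ S) ⊎ (∃ λ u → (u ∈ S) × (arc G u v ≡ true))

  Independent : Subset n → Set
  Independent S = ∀ u v → u ∈ S → v ∈ S → arc G u v ≡ false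

  data Walk (S : Subset n) : Fin n → Fin n → Set where
    step : ∀ {u v} → u ∈ S → v ∈ S → arc G u v ≡ true → Walk S u v
    _∷ʷ_ : ∀ {u v w} → Walk S u v → Walk S v w → Walk S u w

  Acyclic : Subset n → Set
  Acyclic S = ∀ v → ¬ Walk S v v

  IsDominationNumber : ℕ → Set
  IsDominationNumber g =
    (Σ (Subset n) λ S → Dominating S × ∣ S ∣ ≡ g) ×
    (∀ S → Dominating S → g ≤ ∣ S ∣)

  IsIndependenceNumber : ℕ → Set
  IsIndependenceNumber a =
    (Σ (Subset n) λ S → Independent S × ∣ S ∣ ≡ a) ×
    (∀ S → Independent S → ∣ S ∣ ≤ a)

  colourClass : {k : ℕ} → (Fin n → Fin k) → Fin k → Subset n
  colourClass c i = tabulate λ v → isYes (c v ≟ i)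

  AcyclicColouring : (k : ℕ) → (Fin n → Fin k) → Set
  AcyclicColouring k c = ∀ (i : Fin k) → Acyclic (colourClass c i)

  IsDichromaticNumber : ℕ → Set
  IsDichromaticNumber k =
    (Σ (Fin n → Fin k) λ c → AcyclicColouring k c) ×
    (∀ m (c : Fin n → Fin m) → AcyclicColouring m c → k ≤ m)

module Submission where

-- Fix an acyclic colouring c : V(G) → Fin k with k = χ⃗(G).  Each colour
-- class C induces an acyclic digraph, and every acyclic vertex set T
-- contains an independent set S ⊆ T dominating all of T.  Such an S is
-- built greedily: an acyclic nonempty T has a source s (pigeonhole on a
-- backward walk), and we take s together with an independent dominator of
-- T minus the closed out-neighbourhood N⁺[s] of s, obtained by induction
-- on |T|.  The union of these sets over the k classes dominates G and, as
-- each part is independent, has size at most k · α(G); hence γ(G) ≤ α(G) · k.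

open import Defs
open import Data.Nat using (ℕ; zero; suc; _≤_; _<_; _+_; _*_; z≤n; s≤s)
import Data.Nat.Properties as ℕ
open import Data.Fin using (Fin; zero; suc; toℕ; _≟_)
import Data.Fin.Properties as Fin
open import Data.Bool using (Bool; true; false)
import Data.Bool.Properties as Bool
open import Data.Fin.Subset
  using (Subset; _∈_; _∉_; _⊆_; ∣_∣; _∪_; _─_; ⊥; ⁅_⁆; inside; outside)
open import Data.Fin.Subset.Properties
  using ( _∈?_; ∉⊥; ∣⊥∣≡0; ∣p∣≤n; x∈⁅x⁆; x∈⁅y⁆⇒x≡y; x∈p∪q⁺; x∈p∪q⁻; q⊆p∪q
        ; x∈p∩q⁺; x∈p∧x∉q⇒x∈p─q; p─q⊆p; p∩q≢∅⇒∣p─q∣<∣p∣ )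
open import Data.Vec using ([]; _∷_; here; there; tabulate)
import Data.Vec.Properties as Vec
open import Data.Product using (Σ; _×_; ∃; _,_; proj₁; proj₂)
open import Data.Sum using (_⊎_; inj₁; inj₂)
open import Relation.Binary.PropositionalEquality using (_≡_; refl; sym; trans; subst)
open import Relation.Nullary using (¬_; Dec; yes; no; _×-dec_; ¬?; contradiction)
open import Relation.Nullary.Decidable using (isYes; decidable-stable)

∈-tabulate⁺ : ∀ {n} {f : Fin n → Bool} {x} → f x ≡ true → x ∈ tabulate f
∈-tabulate⁺ {f = f} {x} fx = Vec.lookup⇒[]= x (tabulate f) (trans (Vec.lookup∘tabulate f x) fx)

∈-tabulate⁻ : ∀ {n} {f : Fin n → Bool} {x} → x ∈ tabulate f → f x ≡ true
∈-tabulate⁻ {f = f} {x} x∈ = trans (sym (Vec.lookup∘tabulate f x)) (Vec.[]=⇒lookup x∈)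

x∈p─q⇒x∉q : ∀ {n} (p q : Subset n) {x} → x ∈ p ─ q → x ∉ q
x∈p─q⇒x∉q (inside ∷ p) (outside ∷ q) here        ()
x∈p─q⇒x∉q (_      ∷ p) (_       ∷ q) (there x∈) (there x∈q) = x∈p─q⇒x∉q p q x∈ x∈q

∣p∪q∣≤∣p∣+∣q∣ : ∀ {n} (p q : Subset n) → ∣ p ∪ q ∣ ≤ ∣ p ∣ + ∣ q ∣
∣p∪q∣≤∣p∣+∣q∣ []            []            = z≤n
∣p∪q∣≤∣p∣+∣q∣ (outside ∷ p) (outside ∷ q) = ∣p∪q∣≤∣p∣+∣q∣ p q
∣p∪q∣≤∣p∣+∣q∣ (inside  ∷ p) (outside ∷ q) = s≤s (∣p∪q∣≤∣p∣+∣q∣ p q)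
∣p∪q∣≤∣p∣+∣q∣ (outside ∷ p) (inside  ∷ q) =
  ℕ.≤-trans (s≤s (∣p∪q∣≤∣p∣+∣q∣ p q)) (ℕ.≤-reflexive (sym (ℕ.+-suc ∣ p ∣ ∣ q ∣)))
∣p∪q∣≤∣p∣+∣q∣ (inside  ∷ p) (inside  ∷ q) =
  s≤s (ℕ.≤-trans (∣p∪q∣≤∣p∣+∣q∣ p q) (ℕ.+-monoʳ-≤ ∣ p ∣ (ℕ.n≤1+n ∣ q ∣)))

⋃ᶠ : ∀ {n} k → (Fin k → Subset n) → Subset n
⋃ᶠ zero    S = ⊥
⋃ᶠ (suc k) S = S zero ∪ ⋃ᶠ k (λ i → S (suc i))

∈⋃ᶠ : ∀ {n} k (S : Fin k → Subset n) i {x} → x ∈ S i → x ∈ ⋃ᶠ k S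
∈⋃ᶠ (suc k) S zero    x∈ = x∈p∪q⁺ (inj₁ x∈)
∈⋃ᶠ (suc k) S (suc i) x∈ = x∈p∪q⁺ (inj₂ (∈⋃ᶠ k (λ j → S (suc j)) i x∈))

∣⋃ᶠ∣≤ : ∀ {n} k (S : Fin k → Subset n) a → (∀ i → ∣ S i ∣ ≤ a) → ∣ ⋃ᶠ k S ∣ ≤ k * a
∣⋃ᶠ∣≤ {n} zero S a _ = ℕ.≤-reflexive (∣⊥∣≡0 n)
∣⋃ᶠ∣≤ (suc k) S a bound =
  ℕ.≤-trans (∣p∪q∣≤∣p∣+∣q∣ (S zero) _)
            (ℕ.+-mono-≤ (bound zero) (∣⋃ᶠ∣≤ k _ a (λ i → bound (suc i))))

module _ {n : ℕ} (G : Digraph n) where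

  HasInNeighbourIn : Subset n → Fin n → Set
  HasInNeighbourIn S v = ∃ λ u → u ∈ S × arc G u v ≡ true

  hasInNeighbourIn? : ∀ S v → Dec (HasInNeighbourIn S v)
  hasInNeighbourIn? S v = Fin.any? λ u → (u ∈? S) ×-dec (arc G u v Bool.≟ true)

  DominatedBy : Subset n → Fin n → Set
  DominatedBy S v = v ∈ S ⊎ HasInNeighbourIn S v

  IsSource : Subset n → Fin n → Set
  IsSource T s = s ∈ T × ¬ HasInNeighbourIn T s

  walk-mono : ∀ {T U : Subset n} {u v} → T ⊆ U → Walk G T u v → Walk G U u v
  walk-mono T⊆U (step u∈ v∈ uv) = step (T⊆U u∈) (T⊆U v∈) uv
  walk-mono T⊆U (w ∷ʷ w′)       = walk-mono T⊆U w ∷ʷ walk-mono T⊆U w′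

  -- If every vertex of T has an in-neighbour in T, then walking backwards
  -- from a vertex v₀ ∈ T gives vertices x₀, x₁, … of T with arcs x₍ᵢ₊₁₎ → xᵢ.
  module BackwardTrail (T : Subset n) (pred : ∀ v → v ∈ T → HasInNeighbourIn T v)
                       (v₀ : Fin n) (v₀∈T : v₀ ∈ T) where

    trail : ℕ → Σ (Fin n) (_∈ T)
    trail zero    = v₀ , v₀∈T
    trail (suc i) = let (v , v∈T) = trail i in proj₁ (pred v v∈T) , proj₁ (proj₂ (pred v v∈T))

    x : ℕ → Fin n
    x i = proj₁ (trail i)

    trail-arc : ∀ i → arc G (x (suc i)) (x i) ≡ true
    trail-arc i = proj₂ (proj₂ (pred (x i) (proj₂ (trail i))))

    trail-step : ∀ i → Walk G T (x (suc i)) (x i)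
    trail-step i = step (proj₂ (trail (suc i))) (proj₂ (trail i)) (trail-arc i)

    trail-walk : ∀ {i j} → i < j → Walk G T (x j) (x i)
    trail-walk {i} {suc j} (s≤s i≤j) with ℕ.m≤n⇒m<n∨m≡n i≤j
    ... | inj₂ refl = trail-step i
    ... | inj₁ i<j  = trail-step j ∷ʷ trail-walk i<j

    -- Among x₀, …, xₙ two vertices coincide, closing a walk in T.
    closed-walk : ∃ λ v → Walk G T v v
    closed-walk with Fin.pigeonhole (ℕ.n<1+n n) (λ (i : Fin (suc n)) → x (toℕ i))
    ... | i , j , i<j , xᵢ≡xⱼ =
      x (toℕ i) , subst (λ v → Walk G T v (x (toℕ i))) (sym xᵢ≡xⱼ) (trail-walk i<j)

  source : ∀ T → Acyclic G T → ∀ {v₀} → v₀ ∈ T → ∃ (IsSource T)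
  source T acyclic {v₀} v₀∈T with Fin.any? (λ s → (s ∈? T) ×-dec ¬? (hasInNeighbourIn? T s))
  ... | yes src = src
  ... | no noSource = contradiction (proj₂ cycle) (acyclic (proj₁ cycle))
    where
      pred : ∀ v → v ∈ T → HasInNeighbourIn T v
      pred v v∈T = decidable-stable (hasInNeighbourIn? T v) (λ none → noSource (v , v∈T , none))
      cycle : ∃ λ v → Walk G T v v
      cycle = BackwardTrail.closed-walk T pred v₀ v₀∈T

  record IndependentDominator (T : Subset n) : Set where
    field
      set         : Subset n
      ⊆T          : set ⊆ T
      independent : Independent G set
      dominates   : ∀ v → v ∈ T → DominatedBy set v
  open IndependentDominator

  N⁺[_] : Fin n → Subset n
  N⁺[ s ] = ⁅ s ⁆ ∪ tabulate (arc G s)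

  ∈N⁺⁺ : ∀ {s v} → v ≡ s ⊎ arc G s v ≡ true → v ∈ N⁺[ s ]
  ∈N⁺⁺ {s} (inj₁ refl) = x∈p∪q⁺ (inj₁ (x∈⁅x⁆ s))
  ∈N⁺⁺     (inj₂ sv)   = x∈p∪q⁺ (inj₂ (∈-tabulate⁺ sv))

  ∈N⁺⁻ : ∀ {s v} → v ∈ N⁺[ s ] → v ≡ s ⊎ arc G s v ≡ true
  ∈N⁺⁻ {s} v∈ with x∈p∪q⁻ ⁅ s ⁆ _ v∈
  ... | inj₁ v∈⁅s⁆ = inj₁ (x∈⁅y⁆⇒x≡y s v∈⁅s⁆)
  ... | inj₂ v∈out = inj₂ (∈-tabulate⁻ v∈out)

  ∉N⁺⇒no-arc : ∀ {s v} → v ∉ N⁺[ s ] → arc G s v ≡ false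
  ∉N⁺⇒no-arc v∉ = Bool.¬-not (λ sv → v∉ (∈N⁺⁺ (inj₂ sv)))

  -- Adding a source s of T to an independent dominator of T ─ N⁺[s] gives
  -- an independent dominator of T: s is non-adjacent to the rest (it has no
  -- in-neighbour in T and N⁺[s] was removed) and dominates all of N⁺[s].
  add-source : ∀ {T s} → IsSource T s → IndependentDominator (T ─ N⁺[ s ]) →
               IndependentDominator T
  add-source {T} {s} (s∈T , s-source) D = record
    { set = S ; ⊆T = S⊆T ; independent = S-independent ; dominates = S-dominates }
    where
      S : Subset n
      S = ⁅ s ⁆ ∪ set D

      rest⊆T : set D ⊆ T
      rest⊆T v∈ = p─q⊆p T N⁺[ s ] (⊆T D v∈)

      rest∉N⁺ : ∀ {v} → v ∈ set D → v ∉ N⁺[ s ]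
      rest∉N⁺ v∈ = x∈p─q⇒x∉q T N⁺[ s ] (⊆T D v∈)

      s∈S : s ∈ S
      s∈S = x∈p∪q⁺ (inj₁ (x∈⁅x⁆ s))

      rest⊆S : set D ⊆ S
      rest⊆S = q⊆p∪q ⁅ s ⁆ (set D)

      split : ∀ {v} → v ∈ S → v ≡ s ⊎ v ∈ set D
      split {v} v∈ with x∈p∪q⁻ ⁅ s ⁆ (set D) v∈
      ... | inj₁ v∈⁅s⁆ = inj₁ (x∈⁅y⁆⇒x≡y s v∈⁅s⁆)
      ... | inj₂ v∈D   = inj₂ v∈D

      S⊆T : S ⊆ T
      S⊆T v∈ with split v∈
      ... | inj₁ refl = s∈T
      ... | inj₂ v∈D  = rest⊆T v∈D

      S-independent : Independent G S
      S-independent u v u∈ v∈ with split u∈ | split v∈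
      ... | inj₁ refl | inj₁ refl = loopless G u
      ... | inj₁ refl | inj₂ v∈D  = ∉N⁺⇒no-arc (rest∉N⁺ v∈D)
      ... | inj₂ u∈D  | inj₁ refl = Bool.¬-not (λ us → s-source (u , rest⊆T u∈D , us))
      ... | inj₂ u∈D  | inj₂ v∈D  = independent D u v u∈D v∈D

      S-dominates : ∀ v → v ∈ T → DominatedBy S v
      S-dominates v v∈T with v ∈? N⁺[ s ]
      ... | yes v∈N⁺ with ∈N⁺⁻ v∈N⁺
      ...   | inj₁ refl = inj₁ s∈S
      ...   | inj₂ sv   = inj₂ (s , s∈S , sv)
      S-dominates v v∈T | no v∉N⁺ with dominates D v (x∈p∧x∉q⇒x∈p─q v∈T v∉N⁺)
      ...   | inj₁ v∈D            = inj₁ (rest⊆S v∈D)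
      ...   | inj₂ (u , u∈D , uv) = inj₂ (u , rest⊆S u∈D , uv)

  empty-dominator : ∀ {T} → ¬ (∃ λ v → v ∈ T) → IndependentDominator T
  empty-dominator T-empty = record
    { set = ⊥
    ; ⊆T = λ v∈⊥ → contradiction v∈⊥ ∉⊥
    ; independent = λ u v u∈⊥ _ → contradiction u∈⊥ ∉⊥
    ; dominates = λ v v∈T → contradiction (v , v∈T) T-empty
    }

  -- Every acyclic vertex set has an independent dominator; by induction on
  -- an upper bound m for |T|, removing N⁺[s] for a source s each time.
  independent-dominator : ∀ T → Acyclic G T → IndependentDominator T
  independent-dominator T = go (suc n) T (s≤s (∣p∣≤n T))
    where
      go : ∀ m T → ∣ T ∣ < m → Acyclic G T → IndependentDominator T
      go (suc m) T ∣T∣<1+m acyclic with Fin.any? (_∈? T)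
      ... | no T-empty = empty-dominator T-empty
      ... | yes (_ , v₀∈T) with source T acyclic v₀∈T
      ...   | s , s-source = add-source s-source (go m (T ─ N⁺[ s ]) smaller acyclic′)
        where
          smaller : ∣ T ─ N⁺[ s ] ∣ < m
          smaller = ℕ.≤-trans (p∩q≢∅⇒∣p─q∣<∣p∣ T N⁺[ s ] (s , x∈p∩q⁺ (proj₁ s-source , ∈N⁺⁺ (inj₁ refl))))
                              (ℕ.≤-pred ∣T∣<1+m)
          acyclic′ : Acyclic G (T ─ N⁺[ s ])
          acyclic′ v w = acyclic v (walk-mono (p─q⊆p T N⁺[ s ]) w)

  ∈-own-class : ∀ {k} (c : Fin n → Fin k) v → v ∈ colourClass G c (c v)
  ∈-own-class c v = ∈-tabulate⁺ (isYes-refl (c v))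
    where
      isYes-refl : ∀ {k} (i : Fin k) → isYes (i ≟ i) ≡ true
      isYes-refl i with i ≟ i
      ... | yes _   = refl
      ... | no i≢i = contradiction refl i≢i

  colouring⇒small-dominating-set : ∀ {k a} (c : Fin n → Fin k) → AcyclicColouring G k c →
    (∀ S → Independent G S → ∣ S ∣ ≤ a) → ∃ λ D → Dominating G D × ∣ D ∣ ≤ k * a
  colouring⇒small-dominating-set {k} {a} c acyclic α-bound =
    ⋃ᶠ k Sᵢ , D-dominating , ∣⋃ᶠ∣≤ k Sᵢ a (λ i → α-bound (Sᵢ i) (independent (Dᵢ i)))
    where
      Dᵢ : ∀ i → IndependentDominator (colourClass G c i)
      Dᵢ i = independent-dominator (colourClass G c i) (acyclic i)
      Sᵢ : Fin k → Subset n
      Sᵢ i = set (Dᵢ i)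
      D-dominating : Dominating G (⋃ᶠ k Sᵢ)
      D-dominating v with dominates (Dᵢ (c v)) v (∈-own-class c v)
      ... | inj₁ v∈            = inj₁ (∈⋃ᶠ k Sᵢ (c v) v∈)
      ... | inj₂ (u , u∈ , uv) = inj₂ (u , ∈⋃ᶠ k Sᵢ (c v) u∈ , uv)

mainTheorem8 : ∀ {n : ℕ} (G : Digraph n) (g a k : ℕ) →
    IsDominationNumber G g → IsIndependenceNumber G a → IsDichromaticNumber G k →
    g ≤ a * k
mainTheorem8 G g a k (_ , γ-minimal) (_ , α-maximal) ((c , c-acyclic) , _)
  with colouring⇒small-dominating-set G c c-acyclic α-maximal
... | D , D-dominating , ∣D∣≤k*a = begin
  g      ≤⟨ γ-minimal D D-dominating ⟩
  ∣ D ∣  ≤⟨ ∣D∣≤k*a ⟩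
  k * a  ≡⟨ ℕ.*-comm k a ⟩
  a * k  ∎
  where open ℕ.≤-Reasoning
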